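{- Let $u,q\ge 0$ be integers with $\binom{q}{2}\le u$, and let $t\ge 2$. Then \[ k_t(\mathcal{C}(u))+\binom{q}{t-1}\le k_t(\mathcal{C}(u+q)). \]
   Context: $k_t(H)$ denotes the number of cliques on exactly $t$ vertices of a graph $H$. The colex order on $2$-subsets of the positive integers is: $\{i<j\}$ precedes $\{i'<j'\}$ iff $j<j'$, or $j=j'$ and $i<i'$. $\mathcal{C}(m)$ is the graph on the positive integers whose edge set consists of the first $m$ pairs in colex order (up to isolated vertices, if $m=\binom{c}{2}+d$ with $0\le d<c$, a clique on $c$ vertices plus one vertex adjacent to $d$ vertices of the clique). -}

module Defs where

open import Data.Nat using (ℕ; zero; suc; _+_; _<ᵇ_)
open import Data.Nat.Combinatorics using (_C_)
open import Data.Bool using (Bool; true; false; _∧_)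
open import Data.List using (List; []; _∷_; map; _++_; length; filterᵇ; upTo)

-- Vertices are 0-indexed: vertex a here is the positive integer a+1 of the paper.
-- The pair {a < b} has 0-based colex position  (b C 2) + a, so it is among the
-- first m pairs in colex order iff  (b C 2) + a < m.
colexEdge : ℕ → ℕ → ℕ → Bool
colexEdge m a b = (a <ᵇ b) ∧ (((b C 2) + a) <ᵇ m)

-- All k-element sublists (order preserved) of a list: with an increasing
-- input list these are exactly the k-subsets, each listed once, increasingly.
combinations : ℕ → List ℕ → List (List ℕ)
combinations zero    xs       = [] ∷ []
combinations (suc k) []       = []
combinations (suc k) (x ∷ xs) = map (x ∷_) (combinations k xs) ++ combinations (suc k) xs

allᵇ : (ℕ → Bool) → List ℕ → Bool
allᵇ p []       = true
allᵇ p (x ∷ xs) = p x ∧ allᵇ p xs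

isCliqueC : ℕ → List ℕ → Bool
isCliqueC m []       = true
isCliqueC m (x ∷ xs) = allᵇ (colexEdge m x) xs ∧ isCliqueC m xs

-- Every non-isolated vertex of C(m) lies in {0,…,m} (if (b C 2) + a < m then b ≤ m),
-- so for t ≥ 2 the t-cliques of C(m) are exactly the t-cliques among vertices 0..m.
-- kC t m = k_t(C(m)) (for t ≥ 2; for t ≤ 1 it counts within the vertex set {0..m}).
kC : ℕ → ℕ → ℕ
kC t m = length (filterᵇ (isCliqueC m) (combinations t (upTo (suc m))))

module Submission where

-- Write c_m(t, n) (`cliquesBelow m t n`) for the number of t-cliques of C(m) inside the vertex set
-- {0, …, n-1} (vertices are 0-indexed, as in Defs).  The lower neighbours of a
-- vertex n of C(m) form the initial segment {0, …, r-1}, r = min(n, m - (n C 2)),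
-- and this segment is itself a clique.  Splitting the (k+1)-cliques below n+1 by
-- whether they contain n therefore gives the recurrence
--     c_m(k+1, n+1) = c_m(k+1, n) + r C k,
-- from which the closed form follows: for m = (c C 2) + d with d ≤ c,
--     k_t(C(m)) = c C t + d C (t-1)     (t ≥ 2).  Finally, writing u = (c C 2) + d with d < c and noting q ≤ c,
-- the theorem splits into two cases: u + q stays in the same "row"
-- (superadditivity), or it moves to the row c+1 (exchange inequality).

open import Defs
open import Algebra.Bundles using (CommutativeMonoid)
open import Data.Bool using (Bool; true; false; _∧_; T; if_then_else_)
open import Data.Bool.Properties using (∧-commutativeMonoid; T-≡; T-∧)
open import Data.List using (List; []; _∷_; [_]; _++_; _∷ʳ_; map; length; filterᵇ; upTo)
open import Data.List.Properties
  using (filter-++; filter-accept; filter-reject; filter-all; ++-identityʳ; upTo-∷ʳ; length-upTo)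
open import Data.List.Relation.Unary.AllPairs using (AllPairs; []; _∷_)
open import Data.List.Relation.Unary.AllPairs.Properties using (applyUpTo⁺₁)
open import Data.Nat using (ℕ; zero; suc; _+_; _∸_; _⊓_; _≤_; _<_; _<ᵇ_; _≤?_; _<?_; z≤n; s≤s)
open import Data.Nat.Properties
open import Data.Nat.Combinatorics using (_C_; nCk+nC[k+1]≡[n+1]C[k+1]; nC1≡n)
open import Data.Nat.Solver using (module +-*-Solver)
open import Data.Product using (∃₂; _×_; _,_)
open import Function using (_∘_; id; Equivalence)
open import Relation.Binary.PropositionalEquality using (_≡_; refl; sym; trans; cong; cong₂; subst; module ≡-Reasoning)
open import Relation.Nullary using (yes; no)
open import Relation.Nullary.Decidable using (T?)

import Algebra.Properties.CommutativeSemigroup as CommSemigroupProperties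
open CommSemigroupProperties (CommutativeMonoid.commutativeSemigroup ∧-commutativeMonoid)
  using () renaming (interchange to ∧-interchange; x∙yz≈y∙xz to ∧-leftSwap)
open CommSemigroupProperties +-commutativeSemigroup
  using () renaming (interchange to +-interchange)

pascal : ∀ n k → suc n C suc k ≡ n C k + n C suc k
pascal n k = sym (nCk+nC[k+1]≡[n+1]C[k+1] n k)

C-monoˡ : ∀ k {a b} → a ≤ b → a C k ≤ b C k
C-monoˡ zero    _                 = ≤-refl
C-monoˡ (suc k) z≤n               = z≤n
C-monoˡ (suc k) (s≤s {a} {b} a≤b) rewrite pascal a k | pascal b k =
  +-mono-≤ (C-monoˡ k a≤b) (C-monoˡ (suc k) a≤b)

C2-suc : ∀ n → suc n C 2 ≡ n C 2 + n
C2-suc n = trans (pascal n 1) (trans (cong (_+ n C 2) (nC1≡n n)) (+-comm n (n C 2)))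

-- Superadditivity: the (k+1)-subsets of A and those of B are distinct (k+1)-subsets
-- of the disjoint union A ⊎ B.
C-superadditive : ∀ k a b → a C suc k + b C suc k ≤ (a + b) C suc k
C-superadditive k zero    b = ≤-refl
C-superadditive k (suc a) b = begin
  suc a C suc k + b C suc k           ≡⟨ cong (_+ b C suc k) (pascal a k) ⟩
  (a C k + a C suc k) + b C suc k     ≡⟨ +-assoc (a C k) _ _ ⟩
  a C k + (a C suc k + b C suc k)     ≤⟨ +-mono-≤ (C-monoˡ k (m≤m+n a b)) (C-superadditive k a b) ⟩
  (a + b) C k + (a + b) C suc k       ≡⟨ pascal (a + b) k ⟨
  suc (a + b) C suc k                 ∎
  where open ≤-Reasoning

-- Convexity of n ↦ n C s: moving j elements from the smaller of two sets to
-- the larger one does not decrease the total number of s-subsets.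
C-exchange : ∀ s j {e q} → e ≤ q → (j + e) C s + q C s ≤ (j + q) C s + e C s
C-exchange s       zero    {e} {q} _   = ≤-reflexive (+-comm (e C s) (q C s))
C-exchange zero    (suc j)         _   = ≤-refl
C-exchange (suc s) (suc j) {e} {q} e≤q = begin
  suc (j + e) C suc s + q C suc s                ≡⟨ cong (_+ q C suc s) (pascal (j + e) s) ⟩
  ((j + e) C s + (j + e) C suc s) + q C suc s    ≡⟨ +-assoc ((j + e) C s) _ _ ⟩
  (j + e) C s + ((j + e) C suc s + q C suc s)    ≤⟨ +-mono-≤ (C-monoˡ s (+-monoʳ-≤ j e≤q))
                                                              (C-exchange (suc s) j e≤q) ⟩
  (j + q) C s + ((j + q) C suc s + e C suc s)    ≡⟨ +-assoc ((j + q) C s) _ _ ⟨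
  ((j + q) C s + (j + q) C suc s) + e C suc s    ≡⟨ cong (_+ e C suc s) (pascal (j + q) s) ⟨
  suc (j + q) C suc s + e C suc s                ∎
  where open ≤-Reasoning

count : {A : Set} → (A → Bool) → List A → ℕ
count P []       = 0
count P (x ∷ xs) = if P x then suc (count P xs) else count P xs

length-filterᵇ : {A : Set} (P : A → Bool) (xs : List A) → length (filterᵇ P xs) ≡ count P xs
length-filterᵇ P []       = refl
length-filterᵇ P (x ∷ xs) with P x
... | true  = cong suc (length-filterᵇ P xs)
... | false = length-filterᵇ P xs

count-++ : {A : Set} (P : A → Bool) (xs ys : List A) → count P (xs ++ ys) ≡ count P xs + count P ys
count-++ P []       ys = refl
count-++ P (x ∷ xs) ys with P x
... | true  = cong suc (count-++ P xs ys)
... | false = count-++ P xs ys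

count-map : {A B : Set} (P : B → Bool) (f : A → B) (xs : List A) → count P (map f xs) ≡ count (P ∘ f) xs
count-map P f []       = refl
count-map P f (x ∷ xs) with P (f x)
... | true  = cong suc (count-map P f xs)
... | false = count-map P f xs

count-cong : {A : Set} {P Q : A → Bool} → (∀ x → P x ≡ Q x) → (xs : List A) → count P xs ≡ count Q xs
count-cong         P≗Q []       = refl
count-cong {Q = Q} P≗Q (x ∷ xs) rewrite P≗Q x with Q x
... | true  = cong suc (count-cong P≗Q xs)
... | false = count-cong P≗Q xs

count-none : {A : Set} (xs : List A) → count (λ _ → false) xs ≡ 0
count-none []       = refl
count-none (x ∷ xs) = count-none xs

count-combinations-suc : ∀ (P : List ℕ → Bool) k x xs →
  count P (combinations (suc k) (x ∷ xs))
    ≡ count (λ ys → P (x ∷ ys)) (combinations k xs) + count P (combinations (suc k) xs)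
count-combinations-suc P k x xs =
  trans (count-++ P (map (x ∷_) (combinations k xs)) _)
        (cong (_+ count P (combinations (suc k) xs)) (count-map P (x ∷_) (combinations k xs)))

count-combinations-∷ʳ : ∀ (P : List ℕ → Bool) k xs y →
  count P (combinations (suc k) (xs ∷ʳ y))
    ≡ count P (combinations (suc k) xs) + count (λ ys → P (ys ∷ʳ y)) (combinations k xs)
count-combinations-∷ʳ P zero    []       y = refl
count-combinations-∷ʳ P (suc k) []       y = refl
count-combinations-∷ʳ P zero    (x ∷ xs) y = begin
  count P (combinations 1 (x ∷ xs ∷ʳ y))
    ≡⟨ count-combinations-suc P 0 x (xs ∷ʳ y) ⟩
  count P [ [ x ] ] + count P (combinations 1 (xs ∷ʳ y))
    ≡⟨ cong (count P [ [ x ] ] +_) (count-combinations-∷ʳ P 0 xs y) ⟩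
  count P [ [ x ] ] + (count P (combinations 1 xs) + count P [ [ y ] ])
    ≡⟨ +-assoc (count P [ [ x ] ]) _ _ ⟨
  (count P [ [ x ] ] + count P (combinations 1 xs)) + count P [ [ y ] ]
    ≡⟨ cong (_+ count P [ [ y ] ]) (count-combinations-suc P 0 x xs) ⟨
  count P (combinations 1 (x ∷ xs)) + count P [ [ y ] ]
    ∎
  where open ≡-Reasoning
count-combinations-∷ʳ P (suc k) (x ∷ xs) y = begin
  count P (combinations (2 + k) (x ∷ xs ∷ʳ y))
    ≡⟨ count-combinations-suc P (suc k) x (xs ∷ʳ y) ⟩
  count Px (combinations (suc k) (xs ∷ʳ y)) + count P (combinations (2 + k) (xs ∷ʳ y))
    ≡⟨ cong₂ _+_ (count-combinations-∷ʳ Px k xs y) (count-combinations-∷ʳ P (suc k) xs y) ⟩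
  (count Px (combinations (suc k) xs) + count (Py ∘ (x ∷_)) (combinations k xs))
    + (count P (combinations (2 + k) xs) + count Py (combinations (suc k) xs))
    ≡⟨ +-interchange (count Px (combinations (suc k) xs)) _ _ _ ⟩
  (count Px (combinations (suc k) xs) + count P (combinations (2 + k) xs))
    + (count (Py ∘ (x ∷_)) (combinations k xs) + count Py (combinations (suc k) xs))
    ≡⟨ cong₂ _+_ (count-combinations-suc P (suc k) x xs) (count-combinations-suc Py k x xs) ⟨
  count P (combinations (2 + k) (x ∷ xs)) + count Py (combinations (suc k) (x ∷ xs))
    ∎
  where
  open ≡-Reasoning
  Px Py : List ℕ → Bool
  Px ys = P (x ∷ ys)
  Py ys = P (ys ∷ʳ y)

count-combinations-allᵇ : ∀ (p : ℕ → Bool) (Q : List ℕ → Bool) k xs →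
  count (λ ys → allᵇ p ys ∧ Q ys) (combinations k xs) ≡ count Q (combinations k (filterᵇ p xs))
count-combinations-allᵇ p Q zero    xs       = refl
count-combinations-allᵇ p Q (suc k) []       = refl
count-combinations-allᵇ p Q (suc k) (x ∷ xs) with p x in px
... | true  = begin
  count P (combinations (suc k) (x ∷ xs))
    ≡⟨ count-combinations-suc P k x xs ⟩
  count (λ ys → (p x ∧ allᵇ p ys) ∧ Q (x ∷ ys)) (combinations k xs) + count P (combinations (suc k) xs)
    ≡⟨ cong (_+ count P (combinations (suc k) xs))
            (count-cong (λ ys → cong (λ b → (b ∧ allᵇ p ys) ∧ Q (x ∷ ys)) px) (combinations k xs)) ⟩
  count (λ ys → allᵇ p ys ∧ Q (x ∷ ys)) (combinations k xs) + count P (combinations (suc k) xs)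
    ≡⟨ cong₂ _+_ (count-combinations-allᵇ p (Q ∘ (x ∷_)) k xs) (count-combinations-allᵇ p Q (suc k) xs) ⟩
  count (Q ∘ (x ∷_)) (combinations k (filterᵇ p xs)) + count Q (combinations (suc k) (filterᵇ p xs))
    ≡⟨ count-combinations-suc Q k x (filterᵇ p xs) ⟨
  count Q (combinations (suc k) (x ∷ filterᵇ p xs))
    ∎
  where
  open ≡-Reasoning
  P : List ℕ → Bool
  P ys = allᵇ p ys ∧ Q ys
... | false = begin
  count P (combinations (suc k) (x ∷ xs))
    ≡⟨ count-combinations-suc P k x xs ⟩
  count (λ ys → (p x ∧ allᵇ p ys) ∧ Q (x ∷ ys)) (combinations k xs) + count P (combinations (suc k) xs)
    ≡⟨ cong₂ _+_ (trans (count-cong (λ ys → cong (λ b → (b ∧ allᵇ p ys) ∧ Q (x ∷ ys)) px) (combinations k xs))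
                        (count-none (combinations k xs)))
                 (count-combinations-allᵇ p Q (suc k) xs) ⟩
  count Q (combinations (suc k) (filterᵇ p xs))
    ∎
  where
  open ≡-Reasoning
  P : List ℕ → Bool
  P ys = allᵇ p ys ∧ Q ys

Adjacent : ℕ → ℕ → ℕ → Set
Adjacent m a b = T (colexEdge m a b)

-- Every k-sublist of a clique is a clique, so a clique on n vertices contains
-- n C k cliques of size k.
count-combinations-clique : ∀ m k {xs} → AllPairs (Adjacent m) xs →
  count (isCliqueC m) (combinations k xs) ≡ length xs C k
count-combinations-clique m zero    _                   = refl
count-combinations-clique m (suc k) []                  = refl
count-combinations-clique m (suc k) {x ∷ xs} (x~xs ∷ xs-clique) = begin
  count (isCliqueC m) (combinations (suc k) (x ∷ xs))
    ≡⟨ count-combinations-suc (isCliqueC m) k x xs ⟩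
  count (λ ys → allᵇ (colexEdge m x) ys ∧ isCliqueC m ys) (combinations k xs)
    + count (isCliqueC m) (combinations (suc k) xs)
    ≡⟨ cong (_+ count (isCliqueC m) (combinations (suc k) xs))
            (count-combinations-allᵇ (colexEdge m x) (isCliqueC m) k xs) ⟩
  count (isCliqueC m) (combinations k (filterᵇ (colexEdge m x) xs))
    + count (isCliqueC m) (combinations (suc k) xs)
    ≡⟨ cong (λ ys → count (isCliqueC m) (combinations k ys) + count (isCliqueC m) (combinations (suc k) xs))
            (filter-all (T? ∘ colexEdge m x) x~xs) ⟩
  count (isCliqueC m) (combinations k xs) + count (isCliqueC m) (combinations (suc k) xs)
    ≡⟨ cong₂ _+_ (count-combinations-clique m k xs-clique) (count-combinations-clique m (suc k) xs-clique) ⟩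
  length xs C k + length xs C suc k
    ≡⟨ pascal (length xs) k ⟨
  length (x ∷ xs) C suc k
    ∎
  where open ≡-Reasoning

+-<ᵇ-∸ : ∀ c a m → (c + a <ᵇ m) ≡ (a <ᵇ m ∸ c)
+-<ᵇ-∸ zero    a m       = refl
+-<ᵇ-∸ (suc c) a zero    = refl
+-<ᵇ-∸ (suc c) a (suc m) = +-<ᵇ-∸ c a m

colexEdge-below : ∀ m {a n} → a < n → colexEdge m a n ≡ (a <ᵇ m ∸ n C 2)
colexEdge-below m {a} {n} a<n rewrite Equivalence.to T-≡ (<⇒<ᵇ a<n) = +-<ᵇ-∸ (n C 2) a m

adjacent-row : ∀ m {a b} → a < b → suc b C 2 ≤ m → Adjacent m a b
adjacent-row m {a} {b} a<b row-b = Equivalence.from T-∧ (<⇒<ᵇ a<b , <⇒<ᵇ position<m)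
  where
  position<m : b C 2 + a < m
  position<m = ≤-trans (+-monoʳ-< (b C 2) a<b) (≤-trans (≤-reflexive (sym (C2-suc b))) row-b)

upTo-clique : ∀ m j → (∀ {b} → b < j → suc b C 2 ≤ m) → AllPairs (Adjacent m) (upTo j)
upTo-clique m j rows = applyUpTo⁺₁ id j (λ a<b b<j → adjacent-row m a<b (rows b<j))

filterᵇ-upTo : ∀ (p : ℕ → Bool) R N → (∀ {a} → a < N → p a ≡ (a <ᵇ R)) →
  filterᵇ p (upTo N) ≡ upTo (N ⊓ R)
filterᵇ-upTo p R zero    _  = refl
filterᵇ-upTo p R (suc N) p≗ = begin
  filterᵇ p (upTo (suc N))               ≡⟨ cong (filterᵇ p) (upTo-∷ʳ N) ⟨
  filterᵇ p (upTo N ∷ʳ N)                ≡⟨ filter-++ (T? ∘ p) (upTo N) [ N ] ⟩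
  filterᵇ p (upTo N) ++ filterᵇ p [ N ]  ≡⟨ cong (_++ filterᵇ p [ N ]) (filterᵇ-upTo p R N (p≗ ∘ m<n⇒m<1+n)) ⟩
  upTo (N ⊓ R) ++ filterᵇ p [ N ]        ≡⟨ append-last ⟩
  upTo (suc N ⊓ R)                       ∎
  where
  open ≡-Reasoning
  pN : p N ≡ (N <ᵇ R)
  pN = p≗ ≤-refl
  append-last : upTo (N ⊓ R) ++ filterᵇ p [ N ] ≡ upTo (suc N ⊓ R)
  append-last with N <? R
  ... | yes N<R = begin
    upTo (N ⊓ R) ++ filterᵇ p [ N ]  ≡⟨ cong₂ _++_ (cong upTo (m≤n⇒m⊓n≡m (<⇒≤ N<R)))
                                                   (filter-accept (T? ∘ p) (subst T (sym pN) (<⇒<ᵇ N<R))) ⟩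
    upTo N ∷ʳ N                      ≡⟨ upTo-∷ʳ N ⟩
    upTo (suc N)                     ≡⟨ cong upTo (m≤n⇒m⊓n≡m N<R) ⟨
    upTo (suc N ⊓ R)                 ∎
  ... | no N≮R = begin
    upTo (N ⊓ R) ++ filterᵇ p [ N ]  ≡⟨ cong₂ _++_ (cong upTo (m≥n⇒m⊓n≡n R≤N))
                                                   (filter-reject (T? ∘ p) (N≮R ∘ <ᵇ⇒< N R ∘ subst T pN)) ⟩
    upTo R ++ []                     ≡⟨ ++-identityʳ (upTo R) ⟩
    upTo R                           ≡⟨ cong upTo (m≥n⇒m⊓n≡n (m≤n⇒m≤1+n R≤N)) ⟨
    upTo (suc N ⊓ R)                 ∎
    where
    R≤N : R ≤ N
    R≤N = ≮⇒≥ N≮R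

lowerDegree : ℕ → ℕ → ℕ
lowerDegree m n = n ⊓ (m ∸ n C 2)

lowerNeighbours : ∀ m n → filterᵇ (λ a → colexEdge m a n) (upTo n) ≡ upTo (lowerDegree m n)
lowerNeighbours m n = filterᵇ-upTo (λ a → colexEdge m a n) (m ∸ n C 2) n (colexEdge-below m)

lowerNeighbours-clique : ∀ m n → AllPairs (Adjacent m) (upTo (lowerDegree m n))
lowerNeighbours-clique m n = upTo-clique m (lowerDegree m n) rows
  where
  rows : ∀ {b} → b < lowerDegree m n → suc b C 2 ≤ m
  rows b<r = ≤-trans (C-monoˡ 2 (≤-trans b<r (m⊓n≤m n _)))
                     (<⇒≤ (m∸n≢0⇒n<m (m<n⇒n≢0 (≤-trans b<r (m⊓n≤n n _)))))

allᵇ-∷ʳ : ∀ (p : ℕ → Bool) ys y → allᵇ p (ys ∷ʳ y) ≡ p y ∧ allᵇ p ys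
allᵇ-∷ʳ p []       y = refl
allᵇ-∷ʳ p (x ∷ ys) y = trans (cong (p x ∧_) (allᵇ-∷ʳ p ys y)) (∧-leftSwap (p x) (p y) (allᵇ p ys))

isCliqueC-∷ʳ : ∀ m ys y → isCliqueC m (ys ∷ʳ y) ≡ allᵇ (λ a → colexEdge m a y) ys ∧ isCliqueC m ys
isCliqueC-∷ʳ m []       y = refl
isCliqueC-∷ʳ m (x ∷ ys) y =
  trans (cong₂ _∧_ (allᵇ-∷ʳ (colexEdge m x) ys y) (isCliqueC-∷ʳ m ys y))
        (∧-interchange (colexEdge m x y) _ _ _)

cliquesBelow : ℕ → ℕ → ℕ → ℕ
cliquesBelow m t n = count (isCliqueC m) (combinations t (upTo n))

-- The (k+1)-cliques below n+1 containing n are n together with a k-clique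
-- of lower neighbours of n.
cliquesBelow-step : ∀ m k n → cliquesBelow m (suc k) (suc n) ≡ cliquesBelow m (suc k) n + lowerDegree m n C k
cliquesBelow-step m k n = begin
  cliquesBelow m (suc k) (suc n)
    ≡⟨ cong (count Q ∘ combinations (suc k)) (upTo-∷ʳ n) ⟨
  count Q (combinations (suc k) (upTo n ∷ʳ n))
    ≡⟨ count-combinations-∷ʳ Q k (upTo n) n ⟩
  cliquesBelow m (suc k) n + count (λ ys → Q (ys ∷ʳ n)) (combinations k (upTo n))
    ≡⟨ cong (cliquesBelow m (suc k) n +_) extensions ⟩
  cliquesBelow m (suc k) n + lowerDegree m n C k
    ∎
  where
  open ≡-Reasoning
  Q : List ℕ → Bool
  Q = isCliqueC m
  r : ℕ
  r = lowerDegree m n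
  extensions : count (λ ys → Q (ys ∷ʳ n)) (combinations k (upTo n)) ≡ r C k
  extensions = begin
    count (λ ys → Q (ys ∷ʳ n)) (combinations k (upTo n))
      ≡⟨ count-cong (λ ys → isCliqueC-∷ʳ m ys n) (combinations k (upTo n)) ⟩
    count (λ ys → allᵇ (λ a → colexEdge m a n) ys ∧ Q ys) (combinations k (upTo n))
      ≡⟨ count-combinations-allᵇ (λ a → colexEdge m a n) Q k (upTo n) ⟩
    count Q (combinations k (filterᵇ (λ a → colexEdge m a n) (upTo n)))
      ≡⟨ cong (count Q ∘ combinations k) (lowerNeighbours m n) ⟩
    count Q (combinations k (upTo r))
      ≡⟨ count-combinations-clique m k (lowerNeighbours-clique m n) ⟩
    length (upTo r) C k
      ≡⟨ cong (_C k) (length-upTo r) ⟩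
    r C k
      ∎

cliquesBelow-complete : ∀ m t j → j C 2 ≤ m → cliquesBelow m t j ≡ j C t
cliquesBelow-complete m t j row-j =
  trans (count-combinations-clique m t (upTo-clique m j (λ b<j → ≤-trans (C-monoˡ 2 b<j) row-j)))
        (cong (_C t) (length-upTo j))

lowerDegree-row : ∀ {c d} → d ≤ c → lowerDegree (c C 2 + d) c ≡ d
lowerDegree-row {c} {d} d≤c = trans (cong (c ⊓_) (m+n∸m≡n (c C 2) d)) (m≥n⇒m⊓n≡n d≤c)

-- A vertex n with m ≤ n C 2 has no lower neighbours: its row starts after the m-th pair.
lowerDegree-saturated : ∀ m n → m ≤ n C 2 → lowerDegree m n ≡ 0
lowerDegree-saturated m n m≤row = trans (cong (n ⊓_) (m≤n⇒m∸n≡0 m≤row)) (⊓-zeroʳ n)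

cliquesBelow-stable : ∀ m k N → m ≤ N C 2 → ∀ i → cliquesBelow m (2 + k) (i + N) ≡ cliquesBelow m (2 + k) N
cliquesBelow-stable m k _ _     zero    = refl
cliquesBelow-stable m k N m≤row (suc i) = begin
  cliquesBelow m (2 + k) (suc i + N)
    ≡⟨ cliquesBelow-step m (suc k) (i + N) ⟩
  cliquesBelow m (2 + k) (i + N) + lowerDegree m (i + N) C suc k
    ≡⟨ cong (λ r → cliquesBelow m (2 + k) (i + N) + r C suc k)
            (lowerDegree-saturated m (i + N) (≤-trans m≤row (C-monoˡ 2 (m≤n+m N i)))) ⟩
  cliquesBelow m (2 + k) (i + N) + 0
    ≡⟨ +-identityʳ _ ⟩
  cliquesBelow m (2 + k) (i + N)
    ≡⟨ cliquesBelow-stable m k N m≤row i ⟩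
  cliquesBelow m (2 + k) N
    ∎
  where open ≡-Reasoning

cliquesBelow-saturated : ∀ m k N₁ N₂ → m ≤ N₁ C 2 → m ≤ N₂ C 2 →
  cliquesBelow m (2 + k) N₁ ≡ cliquesBelow m (2 + k) N₂
cliquesBelow-saturated m k N₁ N₂ m≤row₁ m≤row₂ = begin
  cliquesBelow m (2 + k) N₁          ≡⟨ cliquesBelow-stable m k N₁ m≤row₁ N₂ ⟨
  cliquesBelow m (2 + k) (N₂ + N₁)   ≡⟨ cong (cliquesBelow m (2 + k)) (+-comm N₂ N₁) ⟩
  cliquesBelow m (2 + k) (N₁ + N₂)   ≡⟨ cliquesBelow-stable m k N₂ m≤row₂ N₁ ⟩
  cliquesBelow m (2 + k) N₂          ∎
  where open ≡-Reasoning

kC-closed : ∀ k {c d} → d ≤ c → kC (2 + k) (c C 2 + d) ≡ c C (2 + k) + d C suc k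
kC-closed k {c} {d} d≤c = begin
  kC (2 + k) m                                  ≡⟨ length-filterᵇ (isCliqueC m) (combinations (2 + k) (upTo (suc m))) ⟩
  cliquesBelow m (2 + k) (suc m)                ≡⟨ cliquesBelow-saturated m k (suc m) (suc c) m≤row-m+1 m≤row-c+1 ⟩
  cliquesBelow m (2 + k) (suc c)                ≡⟨ cliquesBelow-step m (suc k) c ⟩
  cliquesBelow m (2 + k) c + lowerDegree m c C suc k
    ≡⟨ cong₂ _+_ (cliquesBelow-complete m (2 + k) c (m≤m+n (c C 2) d)) (cong (_C suc k) (lowerDegree-row d≤c)) ⟩
  c C (2 + k) + d C suc k                       ∎
  where
  open ≡-Reasoning
  m : ℕ
  m = c C 2 + d
  m≤row-m+1 : m ≤ suc m C 2
  m≤row-m+1 = ≤-trans (m≤n+m m (m C 2)) (≤-reflexive (sym (C2-suc m)))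
  m≤row-c+1 : m ≤ suc c C 2
  m≤row-c+1 = ≤-trans (+-monoʳ-≤ (c C 2) d≤c) (≤-reflexive (sym (C2-suc c)))

-- Every u is (c C 2) + d with d < c: the first u pairs fill c - 1 complete rows
-- and a proper part of the next one.
colex-decomposition : ∀ u → ∃₂ λ c d → d < c × u ≡ c C 2 + d
colex-decomposition zero = 1 , 0 , s≤s z≤n , refl
colex-decomposition (suc u) with colex-decomposition u
... | c , d , d<c , refl with suc d <? c
...   | yes d+1<c = c , suc d , d+1<c , sym (+-suc (c C 2) d)
...   | no  d+1≮c = suc c , 0 , s≤s z≤n , (begin
  suc (c C 2 + d)    ≡⟨ +-suc (c C 2) d ⟨
  c C 2 + suc d      ≡⟨ cong (c C 2 +_) (≤-antisym d<c (≮⇒≥ d+1≮c)) ⟩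
  c C 2 + c          ≡⟨ C2-suc c ⟨
  suc c C 2          ≡⟨ +-identityʳ (suc c C 2) ⟨
  suc c C 2 + 0      ∎)
  where open ≡-Reasoning

row-bound : ∀ {c d q} → d < c → q C 2 ≤ c C 2 + d → q ≤ c
row-bound {c} {d} {q} d<c q²≤u = ≮⇒≥ λ c<q → <⇒≱ (begin-strict
  c C 2 + d  <⟨ +-monoʳ-< (c C 2) d<c ⟩
  c C 2 + c  ≡⟨ C2-suc c ⟨
  suc c C 2  ≤⟨ C-monoˡ 2 c<q ⟩
  q C 2      ∎) q²≤u
  where open ≤-Reasoning

-- Case 1 of the theorem: u + q stays in the row of u (here c = q + j, d ≤ j).
within-row : ∀ k q j {d} → d ≤ j →
  kC (2 + k) ((q + j) C 2 + d) + q C suc k ≤ kC (2 + k) ((q + j) C 2 + d + q)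
within-row k q j {d} d≤j = begin
  kC (2 + k) (c C 2 + d) + q C suc k      ≡⟨ cong (_+ q C suc k) (kC-closed k (≤-trans d≤j (m≤n+m j q))) ⟩
  (c C (2 + k) + d C suc k) + q C suc k  ≡⟨ +-assoc (c C (2 + k)) _ _ ⟩
  c C (2 + k) + (d C suc k + q C suc k)  ≤⟨ +-monoʳ-≤ (c C (2 + k)) (C-superadditive k d q) ⟩
  c C (2 + k) + (d + q) C suc k          ≡⟨ kC-closed k d+q≤c ⟨
  kC (2 + k) (c C 2 + (d + q))           ≡⟨ cong (kC (2 + k)) (+-assoc (c C 2) d q) ⟨
  kC (2 + k) (c C 2 + d + q)             ∎
  where
  open ≤-Reasoning
  c : ℕ
  c = q + j
  d+q≤c : d + q ≤ c
  d+q≤c = ≤-trans (≤-reflexive (+-comm d q)) (+-monoʳ-≤ q d≤j)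

-- Case 2 of the theorem: u + q reaches the next row (c = q + j, d = j + e < c).
across-row : ∀ k q j {e} → j + e < q + j →
  kC (2 + k) ((q + j) C 2 + (j + e)) + q C suc k ≤ kC (2 + k) ((q + j) C 2 + (j + e) + q)
across-row k q j {e} d<c = begin
  kC (2 + k) (c C 2 + (j + e)) + q C suc k        ≡⟨ cong (_+ q C suc k) (kC-closed k (<⇒≤ d<c)) ⟩
  (c C (2 + k) + (j + e) C suc k) + q C suc k     ≡⟨ +-assoc (c C (2 + k)) _ _ ⟩
  c C (2 + k) + ((j + e) C suc k + q C suc k)     ≤⟨ +-monoʳ-≤ (c C (2 + k)) (C-exchange (suc k) j e≤q) ⟩
  c C (2 + k) + ((j + q) C suc k + e C suc k)     ≡⟨ cong (λ x → c C (2 + k) + (x C suc k + e C suc k)) (+-comm j q) ⟩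
  c C (2 + k) + (c C suc k + e C suc k)           ≡⟨ +-assoc (c C (2 + k)) _ _ ⟨
  (c C (2 + k) + c C suc k) + e C suc k           ≡⟨ cong (_+ e C suc k) (trans (pascal c (suc k)) (+-comm (c C suc k) _)) ⟨
  suc c C (2 + k) + e C suc k                     ≡⟨ kC-closed k e≤c+1 ⟨
  kC (2 + k) (suc c C 2 + e)                      ≡⟨ cong (kC (2 + k)) next-row ⟩
  kC (2 + k) (c C 2 + (j + e) + q)                ∎
  where
  open ≤-Reasoning
  open +-*-Solver using (solve; _:=_; _:+_)
  c : ℕ
  c = q + j
  e≤q : e ≤ q
  e≤q = <⇒≤ (+-cancelˡ-< j e q (≤-trans d<c (≤-reflexive (+-comm q j))))
  e≤c+1 : e ≤ suc c
  e≤c+1 = ≤-trans e≤q (≤-trans (m≤m+n q j) (n≤1+n c))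
  next-row : suc c C 2 + e ≡ c C 2 + (j + e) + q
  next-row = trans (cong (_+ e) (C2-suc c))
    (solve 4 (λ X q j e → X :+ (q :+ j) :+ e := X :+ (j :+ e) :+ q) refl (c C 2) q j e)

lemma3p4 : (u q t : ℕ) → q C 2 ≤ u → 2 ≤ t →
    kC t u + q C (t ∸ 1) ≤ kC t (u + q)
lemma3p4 u q (suc (suc k)) q²≤u (s≤s (s≤s z≤n)) with colex-decomposition u
... | c , d , d<c , refl with m≤n⇒∃[o]m+o≡n {q} {c} (row-bound d<c q²≤u)
... | j , refl with d ≤? j
... | yes d≤j = within-row k q j d≤j
... | no  d≰j with m≤n⇒∃[o]m+o≡n {j} {d} (<⇒≤ (≰⇒> d≰j))
... | e , refl = across-row k q j d<c
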